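{- Let $m$ be a positive integer and $\lambda$ a nonzero real number. For integers $n\ge k\ge0$, $$V_{m,\lambda}(n,k)=\sum_{j=k}^{n}\sum_{l=k}^{j}\binom{l}{k}(-1)^{l-k}\langle 1\rangle_{l-k,\lambda}\left(\sum_{i=l}^{j}S_{1,\lambda}(i,l)S_{2}(j,i)\right)S_{1}(n,j)\,m^{n-j}.$$
   Context: For a nonzero real $\lambda$: $(x)_{0,\lambda}=1$, $(x)_{n,\lambda}=x(x-\lambda)\cdots(x-(n-1)\lambda)$; $\langle x\rangle_{0,\lambda}=1$, $\langle x\rangle_{n,\lambda}=x(x+\lambda)\cdots(x+(n-1)\lambda)$ ($n\ge1$); $(x)_n=(x)_{n,1}$. Stirling numbers: $(x)_n=\sum_k S_1(n,k)x^k$, $x^n=\sum_k S_2(n,k)(x)_k$. Degenerate Stirling numbers of the first kind: $(x)_n=\sum_{l=0}^{n}S_{1,\lambda}(n,l)(x)_{l,\lambda}$. Degenerate Whitney numbers of the first kind $V_{m,\lambda}(n,k)$: $m^{n}(x)_{n}=\sum_{k=0}^{n}V_{m,\lambda}(n,k)(mx+1)_{k,\lambda}$. -}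

module Defs where

open import Level using (Level)
open import Algebra.Bundles using (CommutativeRing)
open import Data.Nat using (ℕ; zero; suc)
import Data.Nat as N
open import Data.Integer using (ℤ; +_; -[1+_])
open import Relation.Nullary using (¬_)
open import Data.Sum using (_⊎_)
import Data.Integer as Int

-- Signed Stirling numbers of the first kind: (x)_n = Σ_k S₁(n,k) x^k
S₁ : ℕ → ℕ → ℤ
S₁ zero zero = + 1
S₁ zero (suc k) = + 0
S₁ (suc n) zero = + 0
S₁ (suc n) (suc k) = S₁ n k Int.- (+ n) Int.* S₁ n (suc k)

-- Stirling numbers of the second kind: x^n = Σ_k S₂(n,k) (x)_k
S₂ : ℕ → ℕ → ℕ
S₂ zero zero = 1
S₂ zero (suc k) = 0
S₂ (suc n) zero = 0
S₂ (suc n) (suc k) = suc k N.* S₂ n (suc k) N.+ S₂ n k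

binom : ℕ → ℕ → ℕ
binom n zero = 1
binom zero (suc k) = 0
binom (suc n) (suc k) = binom n k N.+ binom n (suc k)

module Ops {c ℓ : Level} (R : CommutativeRing c ℓ) where
  open CommutativeRing R

  fromℕ : ℕ → Carrier
  fromℕ zero = 0#
  fromℕ (suc n) = 1# + fromℕ n

  fromℤ : ℤ → Carrier
  fromℤ (+ n) = fromℕ n
  fromℤ -[1+ n ] = - fromℕ (suc n)

  pow : Carrier → ℕ → Carrier
  pow x zero = 1#
  pow x (suc n) = pow x n * x

  fallλ : Carrier → Carrier → ℕ → Carrier
  fallλ x lam zero = 1#
  fallλ x lam (suc n) = fallλ x lam n * (x - fromℕ n * lam)

  riseλ : Carrier → Carrier → ℕ → Carrier
  riseλ x lam zero = 1#
  riseλ x lam (suc n) = riseλ x lam n * (x + fromℕ n * lam)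

  fall : Carrier → ℕ → Carrier
  fall x n = fallλ x 1# n

  sumFrom : ℕ → ℕ → (ℕ → Carrier) → Carrier
  sumFrom a zero f = 0#
  sumFrom a (suc n) f = sumFrom a n f + f (a N.+ n)

  -- Σ_{i = a}^{b} f i  (empty, i.e. 0, when b < a)
  Σ[_⋯_] : ℕ → ℕ → (ℕ → Carrier) → Carrier
  Σ[ a ⋯ b ] f = sumFrom a (suc b N.∸ a) f

  CharZero : Set ℓ
  CharZero = ∀ n → ¬ (fromℕ (suc n) ≈ 0#)

  NoZeroDivisors : Set (c Level.⊔ ℓ)
  NoZeroDivisors = ∀ x y → x * y ≈ 0# → (x ≈ 0#) ⊎ (y ≈ 0#)

  IsDegStirling1 : Carrier → (ℕ → ℕ → Carrier) → Set (c Level.⊔ ℓ)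
  IsDegStirling1 lam S = ∀ n x → fall x n ≈ Σ[ 0 ⋯ n ] (λ l → S n l * fallλ x lam l)

  IsDegWhitney1 : ℕ → Carrier → (ℕ → ℕ → Carrier) → Set (c Level.⊔ ℓ)
  IsDegWhitney1 m lam V = ∀ n x →
    pow (fromℕ m) n * fall x n
      ≈ Σ[ 0 ⋯ n ] (λ k → V n k * fallλ (fromℕ m * x + 1#) lam k)

-- Write y = m x and z = y + 1.  Expanding (x)_n in powers gives m^n (x)_n = Σ_j S₁(n,j) m^(n-j) y^j,
-- and three triangular changes of basis  y^j ↦ (y)_i ↦ (y)_{l,λ} ↦ (z)_{k,λ}  (the last one is
-- (z - 1)_{l,λ} = Σ_k C(l,k) (-1)^(l-k) ⟨1⟩_{l-k,λ} (z)_{k,λ}) rewrite m^n (x)_n in the basis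
-- (m x + 1)_{k,λ} with exactly the stated coefficients.  All three basis changes are instances of one
-- fact: if u_{n+1} = u_n (t - α_n) and e_{j+1} = e_j (t - β_j), then u_n = Σ_j a(n,j) e_j for any
-- a satisfying a(n+1,j+1) = a(n,j) + (β_{j+1} - α_n) a(n,j+1).
-- The expansion is unique: (m x + 1)_{k,λ} is a polynomial in x of degree k with leading coefficient
-- m^k, which is not a zero divisor, and in a domain of characteristic zero a polynomial function
-- vanishing at 0, 1, 2, … has zero leading coefficient, by the factor theorem.
module Submission where

open import Defs
open import Level using (Level; _⊔_)
open import Algebra.Bundles using (CommutativeRing)
open import Data.Nat as N using (ℕ; zero; suc; _≤_; _<_; _∸_; z≤n; s≤s; NonZero)
import Data.Nat.Properties as NP
open import Data.Integer as Z using (ℤ; +_; -[1+_]; _⊖_)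
import Data.Integer.Properties as ZP
open import Data.Maybe using (Maybe; just; nothing)
open import Relation.Nullary using (¬_; yes; no)
open import Data.Product using (Σ; _×_; _,_)
open import Data.Sum using (inj₁; inj₂)
open import Data.Empty using (⊥-elim)
open import Relation.Binary.PropositionalEquality as ≡ using (_≡_)
import Algebra.Solver.Ring.AlmostCommutativeRing as ACR

module _ {r ℓ : Level} (R : CommutativeRing r ℓ) where
  open CommutativeRing R hiding (zero)
  open Ops R
  open import Algebra.Properties.Ring ring using (-‿distribˡ-*; -‿distribʳ-*; -0#≈0#)
  open import Algebra.Properties.AbelianGroup +-abelianGroup using (⁻¹-∙-comm)
  open import Algebra.Properties.Group +-group using (⁻¹-involutive; x∙y⁻¹≈ε⇒x≈y; ∙-cancelʳ)
  import Algebra.Definitions.RawMonoid +-rawMonoid as Mult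
  open import Algebra.Properties.Monoid.Mult +-monoid using (×-homo-+)
  open import Algebra.Properties.Semiring.Mult semiring using (×1-homo-*)
  open import Relation.Binary.Reasoning.Setoid setoid

  fromℕ≈×1# : ∀ n → fromℕ n ≈ n Mult.× 1#
  fromℕ≈×1# zero    = refl
  fromℕ≈×1# (suc n) = +-congˡ (fromℕ≈×1# n)

  fromℕ-homo-+ : ∀ m n → fromℕ (m N.+ n) ≈ fromℕ m + fromℕ n
  fromℕ-homo-+ m n = begin
    fromℕ (m N.+ n)      ≈⟨ fromℕ≈×1# (m N.+ n) ⟩
    (m N.+ n) Mult.× 1#  ≈⟨ ×-homo-+ 1# m n ⟩
    m Mult.× 1# + n Mult.× 1# ≈⟨ sym (+-cong (fromℕ≈×1# m) (fromℕ≈×1# n)) ⟩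
    fromℕ m + fromℕ n    ∎

  fromℕ-homo-* : ∀ m n → fromℕ (m N.* n) ≈ fromℕ m * fromℕ n
  fromℕ-homo-* m n = begin
    fromℕ (m N.* n)      ≈⟨ fromℕ≈×1# (m N.* n) ⟩
    (m N.* n) Mult.× 1#  ≈⟨ ×1-homo-* m n ⟩
    m Mult.× 1# * n Mult.× 1# ≈⟨ sym (*-cong (fromℕ≈×1# m) (fromℕ≈×1# n)) ⟩
    fromℕ m * fromℕ n    ∎

  fromℤ-homo-⊖ : ∀ m n → fromℤ (m ⊖ n) ≈ fromℕ m - fromℕ n
  fromℤ-homo-⊖ m       zero    = sym (trans (+-congˡ -0#≈0#) (+-identityʳ _))
  fromℤ-homo-⊖ zero    (suc n) = sym (+-identityˡ _)
  fromℤ-homo-⊖ (suc m) (suc n) = begin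
    fromℤ (suc m ⊖ suc n)             ≡⟨ ≡.cong fromℤ (ZP.[1+m]⊖[1+n]≡m⊖n m n) ⟩
    fromℤ (m ⊖ n)                     ≈⟨ fromℤ-homo-⊖ m n ⟩
    fromℕ m - fromℕ n                 ≈⟨ cancel 1# (fromℕ m) (fromℕ n) ⟩
    (1# + fromℕ m) - (1# + fromℕ n)   ∎
    where
    cancel : ∀ a x y → x - y ≈ (a + x) - (a + y)
    cancel a x y = begin
      x - y                  ≈⟨ sym (+-identityˡ _) ⟩
      0# + (x - y)           ≈⟨ +-congʳ (sym (-‿inverseʳ a)) ⟩
      (a - a) + (x - y)      ≈⟨ +-assoc _ _ _ ⟩
      a + (- a + (x - y))    ≈⟨ +-congˡ (sym (+-assoc _ _ _)) ⟩
      a + ((- a + x) - y)    ≈⟨ +-congˡ (+-congʳ (+-comm _ _)) ⟩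
      a + ((x - a) - y)      ≈⟨ +-congˡ (+-assoc _ _ _) ⟩
      a + (x + (- a - y))    ≈⟨ sym (+-assoc _ _ _) ⟩
      (a + x) + (- a - y)    ≈⟨ +-congˡ (⁻¹-∙-comm a y) ⟩
      (a + x) - (a + y)      ∎

  fromℤ-homo-+ : ∀ i j → fromℤ (i Z.+ j) ≈ fromℤ i + fromℤ j
  fromℤ-homo-+ (+ m)    (+ n)    = fromℕ-homo-+ m n
  fromℤ-homo-+ (+ m)    -[1+ n ] = fromℤ-homo-⊖ m (suc n)
  fromℤ-homo-+ -[1+ m ] (+ n)    = trans (fromℤ-homo-⊖ n (suc m)) (+-comm _ _)
  fromℤ-homo-+ -[1+ m ] -[1+ n ] = begin
    - fromℕ (suc (suc (m N.+ n)))       ≡⟨ ≡.cong (λ k → - fromℕ (suc k)) (≡.sym (NP.+-suc m n)) ⟩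
    - fromℕ (suc m N.+ suc n)           ≈⟨ -‿cong (fromℕ-homo-+ (suc m) (suc n)) ⟩
    - (fromℕ (suc m) + fromℕ (suc n))   ≈⟨ sym (⁻¹-∙-comm _ _) ⟩
    - fromℕ (suc m) - fromℕ (suc n)     ∎

  fromℤ-homo-‿ : ∀ i → fromℤ (Z.- i) ≈ - fromℤ i
  fromℤ-homo-‿ (+ zero)  = sym -0#≈0#
  fromℤ-homo-‿ (+ suc n) = refl
  fromℤ-homo-‿ -[1+ n ]  = sym (⁻¹-involutive _)

  fromℤ-homo-*-+ : ∀ m j → fromℤ (+ m Z.* j) ≈ fromℕ m * fromℤ j
  fromℤ-homo-*-+ m (+ n) = begin
    fromℤ (+ m Z.* + n)  ≡⟨ ≡.cong fromℤ (≡.sym (ZP.pos-* m n)) ⟩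
    fromℕ (m N.* n)      ≈⟨ fromℕ-homo-* m n ⟩
    fromℕ m * fromℕ n    ∎
  fromℤ-homo-*-+ m -[1+ n ] = begin
    fromℤ (+ m Z.* Z.- + suc n)      ≡⟨ ≡.cong fromℤ (≡.sym (ZP.neg-distribʳ-* (+ m) (+ suc n))) ⟩
    fromℤ (Z.- (+ m Z.* + suc n))    ≈⟨ fromℤ-homo-‿ (+ m Z.* + suc n) ⟩
    - fromℤ (+ m Z.* + suc n)        ≈⟨ -‿cong (fromℤ-homo-*-+ m (+ suc n)) ⟩
    - (fromℕ m * fromℕ (suc n))      ≈⟨ -‿distribʳ-* _ _ ⟩
    fromℕ m * - fromℕ (suc n)        ∎

  fromℤ-homo-* : ∀ i j → fromℤ (i Z.* j) ≈ fromℤ i * fromℤ j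
  fromℤ-homo-* (+ m)    j = fromℤ-homo-*-+ m j
  fromℤ-homo-* -[1+ m ] j = begin
    fromℤ (Z.- + suc m Z.* j)
      ≡⟨ ≡.cong fromℤ (≡.sym (ZP.neg-distribˡ-* (+ suc m) j)) ⟩
    fromℤ (Z.- (+ suc m Z.* j))
      ≈⟨ fromℤ-homo-‿ (+ suc m Z.* j) ⟩
    - fromℤ (+ suc m Z.* j)
      ≈⟨ -‿cong (fromℤ-homo-*-+ (suc m) j) ⟩
    - (fromℕ (suc m) * fromℤ j)
      ≈⟨ -‿distribˡ-* _ _ ⟩
    - fromℕ (suc m) * fromℤ j
      ∎

  -- The solver's coefficient map must send + 1 to 1# definitionally, so that 1# can be written con (+ 1).
  ⟦_⟧ℤ : ℤ → Carrier
  ⟦ + 1 ⟧ℤ = 1#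
  ⟦ i   ⟧ℤ = fromℤ i

  ⟦⟧ℤ≈fromℤ : ∀ i → ⟦ i ⟧ℤ ≈ fromℤ i
  ⟦⟧ℤ≈fromℤ (+ 0)           = refl
  ⟦⟧ℤ≈fromℤ (+ 1)           = sym (+-identityʳ 1#)
  ⟦⟧ℤ≈fromℤ (+ suc (suc n)) = refl
  ⟦⟧ℤ≈fromℤ -[1+ n ]        = refl

  ℤ-coefficients : Z.+-*-rawRing ACR.-Raw-AlmostCommutative⟶ ACR.fromCommutativeRing R
  ℤ-coefficients = record
    { ⟦_⟧    = ⟦_⟧ℤ
    ; +-homo = λ i j → homo (Z._+_ i j) (fromℤ-homo-+ i j) (+-cong (⟦⟧ℤ≈fromℤ i) (⟦⟧ℤ≈fromℤ j))
    ; *-homo = λ i j → homo (Z._*_ i j) (fromℤ-homo-* i j) (*-cong (⟦⟧ℤ≈fromℤ i) (⟦⟧ℤ≈fromℤ j))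
    ; -‿homo = λ i → homo (Z.- i) (fromℤ-homo-‿ i) (-‿cong (⟦⟧ℤ≈fromℤ i))
    ; 0-homo = refl
    ; 1-homo = refl
    }
    where
    homo : ∀ k {x y} → fromℤ k ≈ x → y ≈ x → ⟦ k ⟧ℤ ≈ y
    homo k p q = trans (⟦⟧ℤ≈fromℤ k) (trans p (sym q))

  ℤ-coefficient-equality : ∀ i j → Maybe (⟦ i ⟧ℤ ≈ ⟦ j ⟧ℤ)
  ℤ-coefficient-equality i j with i ZP.≟ j
  ... | yes i≡j = just (reflexive (≡.cong ⟦_⟧ℤ i≡j))
  ... | no _    = nothing

  open import Algebra.Solver.Ring Z.+-*-rawRing (ACR.fromCommutativeRing R) ℤ-coefficients ℤ-coefficient-equality
    using (solve; _:=_; con; _:+_; _:*_; _:-_; :-_)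

  binom-vanishes : ∀ {l k} → l < k → binom l k ≡ 0
  binom-vanishes {zero}  {suc k} _ = ≡.refl
  binom-vanishes {suc l} {suc k} (s≤s l<k)
    rewrite binom-vanishes l<k | binom-vanishes (NP.m<n⇒m<1+n l<k) = ≡.refl

  x-0#≈x : ∀ x → x - 0# ≈ x
  x-0#≈x x = trans (+-congˡ -0#≈0#) (+-identityʳ x)

  1#≉0# : CharZero → ¬ (1# ≈ 0#)
  1#≉0# char0 1≈0 = char0 0 (trans (+-identityʳ 1#) 1≈0)

  fromℕ-distinct : CharZero → ∀ i j → i < j → ¬ (fromℕ j - fromℕ i ≈ 0#)
  fromℕ-distinct char0 i j i<j j-i≈0 = char0 e (begin
    fromℕ (suc e)                                ≈⟨ identity (fromℕ i) (fromℕ (suc e)) ⟩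
    (fromℕ i + fromℕ (suc e)) - fromℕ i          ≈⟨ +-congʳ (sym (fromℕ-homo-+ i (suc e))) ⟩
    fromℕ (i N.+ suc e) - fromℕ i                ≡⟨ ≡.cong (λ k → fromℕ k - fromℕ i) i+1+e≡j ⟩
    fromℕ j - fromℕ i                            ≈⟨ j-i≈0 ⟩
    0#                                           ∎)
    where
    e : ℕ
    e = j ∸ suc i
    i+1+e≡j : i N.+ suc e ≡ j
    i+1+e≡j = ≡.trans (NP.+-suc i e) (NP.m+[n∸m]≡n i<j)
    identity : ∀ a d → d ≈ (a + d) - a
    identity = solve 2 (λ a d → d := (a :+ d) :- a) refl

  pow-+ : ∀ x p q → pow x (p N.+ q) ≈ pow x p * pow x q
  pow-+ x p zero    = trans (reflexive (≡.cong (pow x) (NP.+-identityʳ p))) (sym (*-identityʳ _))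
  pow-+ x p (suc q) = begin
    pow x (p N.+ suc q)
      ≡⟨ ≡.cong (pow x) (NP.+-suc p q) ⟩
    pow x (p N.+ q) * x
      ≈⟨ *-congʳ (pow-+ x p q) ⟩
    pow x p * pow x q * x
      ≈⟨ *-assoc _ _ _ ⟩
    pow x p * pow x (suc q)
      ∎

  pow-distrib-* : ∀ x y j → pow (x * y) j ≈ pow x j * pow y j
  pow-distrib-* x y zero    = sym (*-identityʳ 1#)
  pow-distrib-* x y (suc j) = trans (*-congʳ (pow-distrib-* x y j)) (interchange _ _ _ _)
    where
    interchange : ∀ a b c d → a * b * (c * d) ≈ a * c * (b * d)
    interchange = solve 4 (λ a b c d → a :* b :* (c :* d) := a :* c :* (b :* d)) refl

  pow≉0 : NoZeroDivisors → ¬ (1# ≈ 0#) → ∀ {x} → ¬ (x ≈ 0#) → ∀ k → ¬ (pow x k ≈ 0#)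
  pow≉0 nzd 1≉0 x≉0 zero    = 1≉0
  pow≉0 nzd 1≉0 x≉0 (suc k) xᵏ⁺¹≈0 with nzd _ _ xᵏ⁺¹≈0
  ... | inj₁ xᵏ≈0 = pow≉0 nzd 1≉0 x≉0 k xᵏ≈0
  ... | inj₂ x≈0  = x≉0 x≈0

  fallλ-cong : ∀ {x y} lam k → x ≈ y → fallλ x lam k ≈ fallλ y lam k
  fallλ-cong lam zero    x≈y = refl
  fallλ-cong lam (suc k) x≈y = *-cong (fallλ-cong lam k x≈y) (+-congʳ x≈y)

  sumFrom-cong< : ∀ a n {f g : ℕ → Carrier} → (∀ t → t < n → f (a N.+ t) ≈ g (a N.+ t)) →
                  sumFrom a n f ≈ sumFrom a n g
  sumFrom-cong< a zero    f≈g = refl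
  sumFrom-cong< a (suc n) f≈g = +-cong (sumFrom-cong< a n (λ t t<n → f≈g t (NP.m<n⇒m<1+n t<n))) (f≈g n NP.≤-refl)

  sumFrom-cong : ∀ a n {f g : ℕ → Carrier} → (∀ i → f i ≈ g i) → sumFrom a n f ≈ sumFrom a n g
  sumFrom-cong a n f≈g = sumFrom-cong< a n (λ t _ → f≈g (a N.+ t))

  Σ-cong≤ : ∀ N {f g : ℕ → Carrier} → (∀ i → i ≤ N → f i ≈ g i) → Σ[ 0 ⋯ N ] f ≈ Σ[ 0 ⋯ N ] g
  Σ-cong≤ N f≈g = sumFrom-cong< 0 (suc N) (λ i i<1+N → f≈g i (N.s≤s⁻¹ i<1+N))

  sumFrom-+ : ∀ a n (f g : ℕ → Carrier) → sumFrom a n (λ i → f i + g i) ≈ sumFrom a n f + sumFrom a n g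
  sumFrom-+ a zero    f g = sym (+-identityˡ 0#)
  sumFrom-+ a (suc n) f g = trans (+-congʳ (sumFrom-+ a n f g)) (interchange _ _ _ _)
    where
    interchange : ∀ w x y z → (w + x) + (y + z) ≈ (w + y) + (x + z)
    interchange = solve 4 (λ w x y z → (w :+ x) :+ (y :+ z) := (w :+ y) :+ (x :+ z)) refl

  sumFrom-distribˡ : ∀ a n x (f : ℕ → Carrier) → x * sumFrom a n f ≈ sumFrom a n (λ i → x * f i)
  sumFrom-distribˡ a zero    x f = zeroʳ x
  sumFrom-distribˡ a (suc n) x f = trans (distribˡ x _ _) (+-congʳ (sumFrom-distribˡ a n x f))

  sumFrom-distribʳ : ∀ a n x (f : ℕ → Carrier) → sumFrom a n f * x ≈ sumFrom a n (λ i → f i * x)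
  sumFrom-distribʳ a n x f = begin
    sumFrom a n f * x              ≈⟨ *-comm _ x ⟩
    x * sumFrom a n f              ≈⟨ sumFrom-distribˡ a n x f ⟩
    sumFrom a n (λ i → x * f i)    ≈⟨ sumFrom-cong a n (λ i → *-comm x (f i)) ⟩
    sumFrom a n (λ i → f i * x)    ∎

  Σ-shift : ∀ N (f : ℕ → Carrier) → Σ[ 0 ⋯ suc N ] f ≈ f 0 + Σ[ 0 ⋯ N ] (λ i → f (suc i))
  Σ-shift zero    f = trans (+-congʳ (+-identityˡ (f 0))) (+-congˡ (sym (+-identityˡ (f 1))))
  Σ-shift (suc N) f = trans (+-congʳ (Σ-shift N f)) (+-assoc _ _ _)

  Σ-singleton : ∀ a (f : ℕ → Carrier) → Σ[ a ⋯ a ] f ≈ f a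
  Σ-singleton a f = begin
    sumFrom a (suc a ∸ a) f    ≡⟨ ≡.cong (λ n → sumFrom a n f) (NP.m+n∸n≡m 1 a) ⟩
    0# + f (a N.+ 0)           ≡⟨ ≡.cong (λ i → 0# + f i) (NP.+-identityʳ a) ⟩
    0# + f a                   ≈⟨ +-identityˡ (f a) ⟩
    f a                        ∎

  Σ-snoc : ∀ {a b} (f : ℕ → Carrier) → a ≤ suc b → Σ[ a ⋯ suc b ] f ≈ Σ[ a ⋯ b ] f + f (suc b)
  Σ-snoc {a} {b} f a≤1+b = begin
    sumFrom a (suc (suc b) ∸ a) f
      ≡⟨ ≡.cong (λ n → sumFrom a n f) (NP.+-∸-assoc 1 a≤1+b) ⟩
    sumFrom a (suc b ∸ a) f + f (a N.+ (suc b ∸ a))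
      ≡⟨ ≡.cong (λ i → sumFrom a (suc b ∸ a) f + f i) (NP.m+[n∸m]≡n a≤1+b) ⟩
    sumFrom a (suc b ∸ a) f + f (suc b)
      ∎

  Σ-triangle : ∀ N (F : ℕ → ℕ → Carrier) →
               Σ[ 0 ⋯ N ] (λ i → Σ[ 0 ⋯ i ] (F i)) ≈ Σ[ 0 ⋯ N ] (λ l → Σ[ l ⋯ N ] (λ i → F i l))
  Σ-triangle zero    F = refl
  Σ-triangle (suc N) F = begin
    Σ[ 0 ⋯ N ] (λ i → Σ[ 0 ⋯ i ] (F i)) + Σ[ 0 ⋯ suc N ] (F (suc N))
      ≈⟨ +-congʳ (Σ-triangle N F) ⟩
    Σ[ 0 ⋯ N ] (λ l → Σ[ l ⋯ N ] (λ i → F i l)) + (Σ[ 0 ⋯ N ] (F (suc N)) + F (suc N) (suc N))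
      ≈⟨ sym (+-assoc _ _ _) ⟩
    (Σ[ 0 ⋯ N ] (λ l → Σ[ l ⋯ N ] (λ i → F i l)) + Σ[ 0 ⋯ N ] (F (suc N))) + F (suc N) (suc N)
      ≈⟨ +-cong (sym (sumFrom-+ 0 (suc N) _ _)) (sym (Σ-singleton (suc N) (λ i → F i (suc N)))) ⟩
    Σ[ 0 ⋯ N ] (λ l → Σ[ l ⋯ N ] (λ i → F i l) + F (suc N) l) + Σ[ suc N ⋯ suc N ] (λ i → F i (suc N))
      ≈⟨ +-congʳ (Σ-cong≤ N (λ l l≤N → sym (Σ-snoc (λ i → F i l) (NP.m≤n⇒m≤1+n l≤N)))) ⟩
    Σ[ 0 ⋯ N ] (λ l → Σ[ l ⋯ suc N ] (λ i → F i l)) + Σ[ suc N ⋯ suc N ] (λ i → F i (suc N))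
      ∎

  Σ-compose : ∀ j (a : ℕ → Carrier) (b : ℕ → ℕ → Carrier) (v w : ℕ → Carrier) {u : Carrier} →
              u ≈ Σ[ 0 ⋯ j ] (λ i → a i * v i) →
              (∀ i → i ≤ j → v i ≈ Σ[ 0 ⋯ i ] (λ l → b i l * w l)) →
              u ≈ Σ[ 0 ⋯ j ] (λ l → Σ[ l ⋯ j ] (λ i → b i l * a i) * w l)
  Σ-compose j a b v w {u} u≈av v≈bw = begin
    u
      ≈⟨ u≈av ⟩
    Σ[ 0 ⋯ j ] (λ i → a i * v i)
      ≈⟨ Σ-cong≤ j (λ i i≤j → *-congˡ (v≈bw i i≤j)) ⟩
    Σ[ 0 ⋯ j ] (λ i → a i * Σ[ 0 ⋯ i ] (λ l → b i l * w l))
      ≈⟨ sumFrom-cong 0 (suc j) (λ i → sumFrom-distribˡ 0 (suc i) (a i) _) ⟩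
    Σ[ 0 ⋯ j ] (λ i → Σ[ 0 ⋯ i ] (λ l → a i * (b i l * w l)))
      ≈⟨ Σ-triangle j (λ i l → a i * (b i l * w l)) ⟩
    Σ[ 0 ⋯ j ] (λ l → Σ[ l ⋯ j ] (λ i → a i * (b i l * w l)))
      ≈⟨ sumFrom-cong 0 (suc j) (λ l → sumFrom-cong l (suc j ∸ l) (λ i → reorder (a i) (b i l) (w l))) ⟩
    Σ[ 0 ⋯ j ] (λ l → Σ[ l ⋯ j ] (λ i → b i l * a i * w l))
      ≈⟨ sumFrom-cong 0 (suc j) (λ l → sym (sumFrom-distribʳ l (suc j ∸ l) (w l) _)) ⟩
    Σ[ 0 ⋯ j ] (λ l → Σ[ l ⋯ j ] (λ i → b i l * a i) * w l)
      ∎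
    where
    reorder : ∀ x y z → x * (y * z) ≈ y * x * z
    reorder = solve 3 (λ x y z → x :* (y :* z) := y :* x :* z) refl

  module RecurrenceExpansion
    (t : Carrier) (α β : ℕ → Carrier) (a : ℕ → ℕ → Carrier)
    (a-0-0 : a 0 0 ≈ 1#) (a-0-suc : ∀ j → a 0 (suc j) ≈ 0#)
    (a-suc-0 : ∀ n → a (suc n) 0 ≈ (β 0 - α n) * a n 0)
    (a-suc-suc : ∀ n j → a (suc n) (suc j) ≈ a n j + (β (suc j) - α n) * a n (suc j))
    (u e : ℕ → Carrier) (u-0 : u 0 ≈ 1#) (e-0 : e 0 ≈ 1#)
    (u-suc : ∀ n → u (suc n) ≈ u n * (t - α n)) (e-suc : ∀ j → e (suc j) ≈ e j * (t - β j))
    where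

    a-vanishes : ∀ n j → n < j → a n j ≈ 0#
    a-vanishes zero    (suc j) _         = a-0-suc j
    a-vanishes (suc n) (suc j) (s≤s n<j) = begin
      a (suc n) (suc j)
        ≈⟨ a-suc-suc n j ⟩
      a n j + (β (suc j) - α n) * a n (suc j)
        ≈⟨ +-cong (a-vanishes n j n<j) (*-congˡ (a-vanishes n (suc j) (NP.m<n⇒m<1+n n<j))) ⟩
      0# + (β (suc j) - α n) * 0#
        ≈⟨ trans (+-identityˡ _) (zeroʳ _) ⟩
      0#
        ∎

    expansion : ∀ n N → n ≤ N → u n ≈ Σ[ 0 ⋯ N ] (λ j → a n j * e j)
    expansion zero zero _ = begin
      u 0                ≈⟨ u-0 ⟩
      1#                 ≈⟨ solve 0 (con (+ 1) := con (+ 0) :+ con (+ 1) :* con (+ 1)) refl ⟩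
      0# + 1# * 1#       ≈⟨ +-congˡ (sym (*-cong a-0-0 e-0)) ⟩
      0# + a 0 0 * e 0   ∎
    expansion zero (suc N) _ = begin
      u 0
        ≈⟨ sym (+-identityʳ _) ⟩
      u 0 + 0#
        ≈⟨ +-cong (expansion zero N z≤n) (sym (trans (*-congʳ (a-0-suc N)) (zeroˡ _))) ⟩
      Σ[ 0 ⋯ N ] (λ j → a 0 j * e j) + a 0 (suc N) * e (suc N)
        ∎
    expansion (suc n) (suc N) (s≤s n≤N) = begin
      u (suc n)
        ≈⟨ u-suc n ⟩
      u n * (t - α n)
        ≈⟨ *-congʳ (expansion n N n≤N) ⟩
      Σ[ 0 ⋯ N ] (λ j → a n j * e j) * (t - α n)
        ≈⟨ sumFrom-distribʳ 0 (suc N) _ _ ⟩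
      Σ[ 0 ⋯ N ] (λ j → a n j * e j * (t - α n))
        ≈⟨ sumFrom-cong 0 (suc N) split ⟩
      Σ[ 0 ⋯ N ] (λ j → d j + c j)
        ≈⟨ sumFrom-+ 0 (suc N) d c ⟩
      Σ[ 0 ⋯ N ] d + Σ[ 0 ⋯ N ] c
        ≈⟨ +-congˡ Σc-shift ⟩
      Σ[ 0 ⋯ N ] d + (c 0 + Σ[ 0 ⋯ N ] (λ j → c (suc j)))
        ≈⟨ rearrange _ _ _ ⟩
      c 0 + (Σ[ 0 ⋯ N ] d + Σ[ 0 ⋯ N ] (λ j → c (suc j)))
        ≈⟨ +-cong c0 (sym (sumFrom-+ 0 (suc N) d (λ j → c (suc j)))) ⟩
      a (suc n) 0 * e 0 + Σ[ 0 ⋯ N ] (λ j → d j + c (suc j))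
        ≈⟨ +-congˡ (sumFrom-cong 0 (suc N) merge) ⟩
      a (suc n) 0 * e 0 + Σ[ 0 ⋯ N ] (λ j → a (suc n) (suc j) * e (suc j))
        ≈⟨ sym (Σ-shift N _) ⟩
      Σ[ 0 ⋯ suc N ] (λ j → a (suc n) j * e j)
        ∎
      where
      d c : ℕ → Carrier
      d j = a n j * e (suc j)
      c j = (β j - α n) * (a n j * e j)

      split : ∀ j → a n j * e j * (t - α n) ≈ d j + c j
      split j = trans (identity (a n j) (e j) t (α n) (β j)) (+-congʳ (*-congˡ (sym (e-suc j))))
        where
        identity : ∀ x E t α β → x * E * (t - α) ≈ x * (E * (t - β)) + (β - α) * (x * E)
        identity = solve 5 (λ x E t α β → x :* E :* (t :- α) := x :* (E :* (t :- β)) :+ (β :- α) :* (x :* E)) refl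

      rearrange : ∀ x y z → x + (y + z) ≈ y + (x + z)
      rearrange = solve 3 (λ x y z → x :+ (y :+ z) := y :+ (x :+ z)) refl

      Σc-shift : Σ[ 0 ⋯ N ] c ≈ c 0 + Σ[ 0 ⋯ N ] (λ j → c (suc j))
      Σc-shift = begin
        Σ[ 0 ⋯ N ] c                        ≈⟨ sym (+-identityʳ _) ⟩
        Σ[ 0 ⋯ N ] c + 0#                   ≈⟨ +-congˡ (sym c-top) ⟩
        Σ[ 0 ⋯ suc N ] c                    ≈⟨ Σ-shift N c ⟩
        c 0 + Σ[ 0 ⋯ N ] (λ j → c (suc j))  ∎
        where
        c-top : c (suc N) ≈ 0#
        c-top = trans (*-congˡ (trans (*-congʳ (a-vanishes n (suc N) (s≤s n≤N))) (zeroˡ _))) (zeroʳ _)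

      c0 : c 0 ≈ a (suc n) 0 * e 0
      c0 = trans (sym (*-assoc _ _ _)) (*-congʳ (sym (a-suc-0 n)))

      merge : ∀ j → d j + c (suc j) ≈ a (suc n) (suc j) * e (suc j)
      merge j = begin
        a n j * E + (β (suc j) - α n) * (a n (suc j) * E)     ≈⟨ +-congˡ (sym (*-assoc _ _ _)) ⟩
        a n j * E + (β (suc j) - α n) * a n (suc j) * E       ≈⟨ sym (distribʳ E _ _) ⟩
        (a n j + (β (suc j) - α n) * a n (suc j)) * E         ≈⟨ *-congʳ (sym (a-suc-suc n j)) ⟩
        a (suc n) (suc j) * E                                 ∎
        where
        E : Carrier
        E = e (suc j)

  fall-expansion : ∀ x n → fall x n ≈ Σ[ 0 ⋯ n ] (λ j → fromℤ (S₁ n j) * pow x j)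
  fall-expansion x n = expansion n n NP.≤-refl
    where
    a-suc-0 : ∀ n → fromℤ (S₁ (suc n) 0) ≈ (0# - fromℕ n * 1#) * fromℤ (S₁ n 0)
    a-suc-0 zero    = solve 0 (con (+ 0) := (con (+ 0) :- con (+ 0) :* con (+ 1)) :* (con (+ 1) :+ con (+ 0))) refl
    a-suc-0 (suc n) = sym (zeroʳ _)

    a-suc-suc : ∀ n j → fromℤ (S₁ (suc n) (suc j))
                        ≈ fromℤ (S₁ n j) + (0# - fromℕ n * 1#) * fromℤ (S₁ n (suc j))
    a-suc-suc n j = begin
      fromℤ (S₁ n j Z.+ Z.- (+ n Z.* S₁ n (suc j)))
        ≈⟨ fromℤ-homo-+ (S₁ n j) _ ⟩
      fromℤ (S₁ n j) + fromℤ (Z.- (+ n Z.* S₁ n (suc j)))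
        ≈⟨ +-congˡ (trans (fromℤ-homo-‿ (+ n Z.* S₁ n (suc j))) (-‿cong (fromℤ-homo-* (+ n) (S₁ n (suc j))))) ⟩
      fromℤ (S₁ n j) - fromℕ n * fromℤ (S₁ n (suc j))
        ≈⟨ +-congˡ (identity (fromℕ n) _) ⟩
      fromℤ (S₁ n j) + (0# - fromℕ n * 1#) * fromℤ (S₁ n (suc j))
        ∎
      where
      identity : ∀ n s → - (n * s) ≈ (0# - n * 1#) * s
      identity = solve 2 (λ n s → :- (n :* s) := (con (+ 0) :- n :* con (+ 1)) :* s) refl

    open RecurrenceExpansion x (λ n → fromℕ n * 1#) (λ _ → 0#) (λ n j → fromℤ (S₁ n j))
      (+-identityʳ 1#) (λ _ → refl) a-suc-0 a-suc-suc
      (fall x) (pow x) refl refl (λ _ → refl) (λ j → *-congˡ (sym (x-0#≈x x)))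

  pow-expansion : ∀ y j → pow y j ≈ Σ[ 0 ⋯ j ] (λ i → fromℕ (S₂ j i) * fall y i)
  pow-expansion y j = expansion j j NP.≤-refl
    where
    a-suc-0 : ∀ j → fromℕ (S₂ (suc j) 0) ≈ (0# * 1# - 0#) * fromℕ (S₂ j 0)
    a-suc-0 j = solve 1 (λ s → con (+ 0) := (con (+ 0) :* con (+ 1) :- con (+ 0)) :* s) refl (fromℕ (S₂ j 0))

    a-suc-suc : ∀ j i → fromℕ (S₂ (suc j) (suc i))
                        ≈ fromℕ (S₂ j i) + (fromℕ (suc i) * 1# - 0#) * fromℕ (S₂ j (suc i))
    a-suc-suc j i = begin
      fromℕ (suc i N.* S₂ j (suc i) N.+ S₂ j i)
        ≈⟨ fromℕ-homo-+ (suc i N.* S₂ j (suc i)) (S₂ j i) ⟩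
      fromℕ (suc i N.* S₂ j (suc i)) + fromℕ (S₂ j i)
        ≈⟨ +-congʳ (fromℕ-homo-* (suc i) (S₂ j (suc i))) ⟩
      fromℕ (suc i) * fromℕ (S₂ j (suc i)) + fromℕ (S₂ j i)
        ≈⟨ identity _ _ _ ⟩
      fromℕ (S₂ j i) + (fromℕ (suc i) * 1# - 0#) * fromℕ (S₂ j (suc i))
        ∎
      where
      identity : ∀ i s s′ → i * s + s′ ≈ s′ + (i * 1# - 0#) * s
      identity = solve 3 (λ i s s′ → i :* s :+ s′ := s′ :+ (i :* con (+ 1) :- con (+ 0)) :* s) refl

    open RecurrenceExpansion y (λ _ → 0#) (λ i → fromℕ i * 1#) (λ j i → fromℕ (S₂ j i))
      (+-identityʳ 1#) (λ _ → refl) a-suc-0 a-suc-suc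
      (pow y) (fall y) refl refl (λ j → *-congˡ (sym (x-0#≈x y))) (λ _ → refl)

  -- For k > l the truncated l ∸ k is harmless, since then binom l k = 0.
  shiftCoeff : Carrier → ℕ → ℕ → Carrier
  shiftCoeff lam l k = fromℕ (binom l k) * pow (- 1#) (l ∸ k) * riseλ 1# lam (l ∸ k)

  fallλ-shift-expansion : ∀ lam z l → fallλ (z - 1#) lam l ≈ Σ[ 0 ⋯ l ] (λ k → shiftCoeff lam l k * fallλ z lam k)
  fallλ-shift-expansion lam z l = expansion l l NP.≤-refl
    where
    a-0-0 : shiftCoeff lam 0 0 ≈ 1#
    a-0-0 = solve 0 ((con (+ 1) :+ con (+ 0)) :* con (+ 1) :* con (+ 1) := con (+ 1)) refl

    a-0-suc : ∀ k → shiftCoeff lam 0 (suc k) ≈ 0#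
    a-0-suc k = trans (*-congʳ (zeroˡ _)) (zeroˡ _)

    a-suc-0 : ∀ l → shiftCoeff lam (suc l) 0 ≈ (fromℕ 0 * lam - (1# + fromℕ l * lam)) * shiftCoeff lam l 0
    a-suc-0 l = identity (pow (- 1#) l) (riseλ 1# lam l) (fromℕ l) lam
      where
      identity : ∀ P Q L lam → (1# + 0#) * (P * - 1#) * (Q * (1# + L * lam))
                               ≈ (0# * lam - (1# + L * lam)) * ((1# + 0#) * P * Q)
      identity = solve 4 (λ P Q L lam → (con (+ 1) :+ con (+ 0)) :* (P :* (:- con (+ 1))) :* (Q :* (con (+ 1) :+ L :* lam))
                                       := (con (+ 0) :* lam :- (con (+ 1) :+ L :* lam)) :* ((con (+ 1) :+ con (+ 0)) :* P :* Q)) refl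

    upper-term : ∀ l k → fromℕ (binom l (suc k)) * pow (- 1#) (l ∸ k) * riseλ 1# lam (l ∸ k)
                         ≈ (fromℕ (suc k) * lam - (1# + fromℕ l * lam)) * shiftCoeff lam l (suc k)
    upper-term l k with suc k N.≤? l
    ... | no l<1+k rewrite binom-vanishes (NP.≰⇒> l<1+k) =
      trans (*-congʳ (zeroˡ _)) (trans (zeroˡ _) (sym (trans (*-congˡ (trans (*-congʳ (zeroˡ _)) (zeroˡ _))) (zeroʳ _))))
    ... | yes 1+k≤l rewrite NP.+-∸-assoc 1 1+k≤l = begin
      C * (P * - 1#) * (Q * (1# + D * lam))
        ≈⟨ identity C P Q D K lam ⟩
      (K * lam - (1# + (K + D) * lam)) * (C * P * Q)
        ≈⟨ *-congʳ (+-congˡ (-‿cong (+-congˡ (*-congʳ (sym l≈K+D))))) ⟩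
      (K * lam - (1# + fromℕ l * lam)) * (C * P * Q)
        ∎
      where
      C P Q D K : Carrier
      C = fromℕ (binom l (suc k))
      P = pow (- 1#) (l ∸ suc k)
      Q = riseλ 1# lam (l ∸ suc k)
      D = fromℕ (l ∸ suc k)
      K = fromℕ (suc k)
      l≈K+D : fromℕ l ≈ K + D
      l≈K+D = trans (reflexive (≡.cong fromℕ (≡.sym (NP.m+[n∸m]≡n 1+k≤l)))) (fromℕ-homo-+ (suc k) (l ∸ suc k))
      identity : ∀ C P Q D K lam → C * (P * - 1#) * (Q * (1# + D * lam)) ≈ (K * lam - (1# + (K + D) * lam)) * (C * P * Q)
      identity = solve 6 (λ C P Q D K lam → C :* (P :* (:- con (+ 1))) :* (Q :* (con (+ 1) :+ D :* lam))
                                           := (K :* lam :- (con (+ 1) :+ (K :+ D) :* lam)) :* (C :* P :* Q)) refl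

    a-suc-suc : ∀ l k → shiftCoeff lam (suc l) (suc k)
                        ≈ shiftCoeff lam l k + (fromℕ (suc k) * lam - (1# + fromℕ l * lam)) * shiftCoeff lam l (suc k)
    a-suc-suc l k = begin
      fromℕ (binom l k N.+ binom l (suc k)) * P * Q
        ≈⟨ *-congʳ (*-congʳ (fromℕ-homo-+ (binom l k) (binom l (suc k)))) ⟩
      (fromℕ (binom l k) + fromℕ (binom l (suc k))) * P * Q
        ≈⟨ trans (*-congʳ (distribʳ P _ _)) (distribʳ Q _ _) ⟩
      shiftCoeff lam l k + fromℕ (binom l (suc k)) * P * Q
        ≈⟨ +-congˡ (upper-term l k) ⟩
      shiftCoeff lam l k + (fromℕ (suc k) * lam - (1# + fromℕ l * lam)) * shiftCoeff lam l (suc k)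
        ∎
      where
      P Q : Carrier
      P = pow (- 1#) (l ∸ k)
      Q = riseλ 1# lam (l ∸ k)

    u-suc : ∀ l → fallλ (z - 1#) lam (suc l) ≈ fallλ (z - 1#) lam l * (z - (1# + fromℕ l * lam))
    u-suc l = *-congˡ (identity z (fromℕ l * lam))
      where
      identity : ∀ z x → (z - 1#) - x ≈ z - (1# + x)
      identity = solve 2 (λ z x → (z :- con (+ 1)) :- x := z :- (con (+ 1) :+ x)) refl

    open RecurrenceExpansion z (λ l → 1# + fromℕ l * lam) (λ k → fromℕ k * lam) (shiftCoeff lam)
      a-0-0 a-0-suc a-suc-0 a-suc-suc
      (fallλ (z - 1#) lam) (fallλ z lam) refl refl u-suc (λ _ → refl)

  -- IsPoly c d f : f is a polynomial function of degree ≤ d with coefficient c at x ^ d,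
  -- witnessed by repeatedly writing f x = f 0 + x * g x.
  data IsPoly (c : Carrier) : ℕ → (Carrier → Carrier) → Set (r ⊔ ℓ) where
    constant : ∀ {f} → (∀ x → f x ≈ c) → IsPoly c 0 f
    step     : ∀ {d f} g → IsPoly c d g → (∀ x → f x ≈ f 0# + x * g x) → IsPoly c (suc d) f

  IsPoly-cong : ∀ {c c′ d f g} → IsPoly c d f → (∀ x → f x ≈ g x) → c ≈ c′ → IsPoly c′ d g
  IsPoly-cong (constant f≈c) f≈g c≈c′ = constant (λ x → trans (sym (f≈g x)) (trans (f≈c x) c≈c′))
  IsPoly-cong (step h P f≈) f≈g c≈c′ =
    step h (IsPoly-cong P (λ _ → refl) c≈c′) (λ x → trans (sym (f≈g x)) (trans (f≈ x) (+-congʳ (f≈g 0#))))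

  IsPoly-raise : ∀ {c d f} → IsPoly c d f → IsPoly 0# (suc d) f
  IsPoly-raise {f = f} (constant f≈c) =
    step (λ _ → 0#) (constant (λ _ → refl)) (λ x → begin
      f x
        ≈⟨ trans (f≈c x) (sym (f≈c 0#)) ⟩
      f 0#
        ≈⟨ sym (+-identityʳ _) ⟩
      f 0# + 0#
        ≈⟨ +-congˡ (sym (zeroʳ x)) ⟩
      f 0# + x * 0#   ∎)
  IsPoly-raise (step g P f≈) = step g (IsPoly-raise P) f≈

  IsPoly-+ : ∀ {c c′ d f g} → IsPoly c d f → IsPoly c′ d g → IsPoly (c + c′) d (λ x → f x + g x)
  IsPoly-+ (constant f≈c) (constant g≈c′) = constant (λ x → +-cong (f≈c x) (g≈c′ x))
  IsPoly-+ {f = f} {g} (step f₁ P f≈) (step g₁ Q g≈) =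
    step (λ x → f₁ x + g₁ x) (IsPoly-+ P Q)
      (λ x → trans (+-cong (f≈ x) (g≈ x)) (identity (f 0#) (g 0#) x (f₁ x) (g₁ x)))
    where
    identity : ∀ a b x u v → (a + x * u) + (b + x * v) ≈ (a + b) + x * (u + v)
    identity = solve 5 (λ a b x u v → (a :+ x :* u) :+ (b :+ x :* v) := (a :+ b) :+ x :* (u :+ v)) refl

  IsPoly-*ˡ : ∀ a {c d f} → IsPoly c d f → IsPoly (a * c) d (λ x → a * f x)
  IsPoly-*ˡ a (constant f≈c) = constant (λ x → *-congˡ (f≈c x))
  IsPoly-*ˡ a {f = f} (step g P f≈) =
    step (λ x → a * g x) (IsPoly-*ˡ a P) (λ x → trans (*-congˡ (f≈ x)) (identity a (f 0#) x (g x)))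
    where
    identity : ∀ a b x u → a * (b + x * u) ≈ a * b + x * (a * u)
    identity = solve 4 (λ a b x u → a :* (b :+ x :* u) := a :* b :+ x :* (a :* u)) refl

  IsPoly-x* : ∀ {c d f} → IsPoly c d f → IsPoly c (suc d) (λ x → x * f x)
  IsPoly-x* {f = f} P = step f P (λ x → sym (trans (+-congʳ (zeroˡ (f 0#))) (+-identityˡ _)))

  IsPoly-factor : ∀ {c d f} → IsPoly c (suc d) f → ∀ ρ →
                  Σ (Carrier → Carrier) (λ g → IsPoly c d g × (∀ x → f x ≈ f ρ + (x - ρ) * g x))
  IsPoly-factor {c} {f = f} (step g (constant g≈c) f≈) ρ = (λ _ → c) , constant (λ _ → refl) , λ x → begin
    f x                          ≈⟨ trans (f≈ x) (+-congˡ (*-congˡ (g≈c x))) ⟩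
    f 0# + x * c                 ≈⟨ identity (f 0#) x ρ c ⟩
    (f 0# + ρ * c) + (x - ρ) * c ≈⟨ +-congʳ (sym (trans (f≈ ρ) (+-congˡ (*-congˡ (g≈c ρ))))) ⟩
    f ρ + (x - ρ) * c            ∎
    where
    identity : ∀ a x ρ c → a + x * c ≈ (a + ρ * c) + (x - ρ) * c
    identity = solve 4 (λ a x ρ c → a :+ x :* c := (a :+ ρ :* c) :+ (x :- ρ) :* c) refl
  IsPoly-factor {f = f} (step g P@(step _ _ _) f≈) ρ with IsPoly-factor P ρ
  ... | h , Q , g≈ = (λ x → g ρ + x * h x) , step h Q (λ x → identity₁ (g ρ) x (h x) (h 0#)) , λ x → begin
    f x
      ≈⟨ f≈ x ⟩
    f 0# + x * g x
      ≈⟨ +-congˡ (*-congˡ (g≈ x)) ⟩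
    f 0# + x * (g ρ + (x - ρ) * h x)
      ≈⟨ identity₂ (f 0#) x ρ (g ρ) (h x) ⟩
    (f 0# + ρ * g ρ) + (x - ρ) * (g ρ + x * h x) ≈⟨ +-congʳ (sym (f≈ ρ)) ⟩
    f ρ + (x - ρ) * (g ρ + x * h x)
      ∎
    where
    identity₁ : ∀ a x u v → a + x * u ≈ (a + 0# * v) + x * u
    identity₁ = solve 4 (λ a x u v → a :+ x :* u := (a :+ con (+ 0) :* v) :+ x :* u) refl
    identity₂ : ∀ a x ρ g h → a + x * (g + (x - ρ) * h) ≈ (a + ρ * g) + (x - ρ) * (g + x * h)
    identity₂ = solve 5 (λ a x ρ g h → a :+ x :* (g :+ (x :- ρ) :* h) := (a :+ ρ :* g) :+ (x :- ρ) :* (g :+ x :* h)) refl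

  IsPoly-roots⇒lead≈0 : NoZeroDivisors → ∀ {c d f} (p : ℕ → Carrier) →
                        (∀ i j → i < j → ¬ (p j - p i ≈ 0#)) → IsPoly c d f → (∀ i → f (p i) ≈ 0#) → c ≈ 0#
  IsPoly-roots⇒lead≈0 nzd p p-distinct (constant f≈c) f∘p≈0 = trans (sym (f≈c (p 0))) (f∘p≈0 0)
  IsPoly-roots⇒lead≈0 nzd {f = f} p p-distinct P@(step _ _ _) f∘p≈0 with IsPoly-factor P (p 0)
  ... | g , Q , f≈ =
    IsPoly-roots⇒lead≈0 nzd (λ i → p (suc i)) (λ i j i<j → p-distinct (suc i) (suc j) (s≤s i<j)) Q g∘p≈0
    where
    g∘p≈0 : ∀ i → g (p (suc i)) ≈ 0#
    g∘p≈0 i with nzd (p (suc i) - p 0) (g (p (suc i))) (begin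
      (p (suc i) - p 0) * g (p (suc i))
        ≈⟨ sym (+-identityˡ _) ⟩
      0# + (p (suc i) - p 0) * g (p (suc i))
        ≈⟨ +-congʳ (sym (f∘p≈0 0)) ⟩
      f (p 0) + (p (suc i) - p 0) * g (p (suc i)) ≈⟨ sym (f≈ (p (suc i))) ⟩
      f (p (suc i))
        ≈⟨ f∘p≈0 (suc i) ⟩
      0#                                          ∎)
    ... | inj₁ p≈p₀ = ⊥-elim (p-distinct 0 (suc i) (s≤s z≤n) p≈p₀)
    ... | inj₂ g≈0  = g≈0

  module ExpansionUniqueness
    (nzd : NoZeroDivisors) (p : ℕ → Carrier) (p-distinct : ∀ i j → i < j → ¬ (p j - p i ≈ 0#))
    (b : ℕ → Carrier → Carrier) (lc : ℕ → Carrier)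
    (b-poly : ∀ k → IsPoly (lc k) k (b k)) (lc≉0 : ∀ k → ¬ (lc k ≈ 0#))
    where

    Σ-IsPoly : ∀ N (c : ℕ → Carrier) → IsPoly (c N * lc N) N (λ x → Σ[ 0 ⋯ N ] (λ k → c k * b k x))
    Σ-IsPoly zero    c = IsPoly-cong (IsPoly-*ˡ (c 0) (b-poly 0)) (λ _ → sym (+-identityˡ _)) refl
    Σ-IsPoly (suc N) c =
      IsPoly-cong (IsPoly-+ (IsPoly-raise (Σ-IsPoly N c)) (IsPoly-*ˡ (c (suc N)) (b-poly (suc N))))
        (λ _ → refl) (+-identityˡ _)

    top-coefficient-unique : ∀ N (c d : ℕ → Carrier) →
      (∀ x → Σ[ 0 ⋯ N ] (λ k → c k * b k x) ≈ Σ[ 0 ⋯ N ] (λ k → d k * b k x)) → c N ≈ d N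
    top-coefficient-unique N c d Σc≈Σd with nzd (c N - d N) (lc N) (begin
      (c N - d N) * lc N
        ≈⟨ difference (c N) (d N) (lc N) ⟩
      c N * lc N + - 1# * (d N * lc N)
        ≈⟨ IsPoly-roots⇒lead≈0 nzd p p-distinct difference-poly vanishes ⟩
      0#                                         ∎)
      where
      difference : ∀ c d l → (c - d) * l ≈ c * l + - 1# * (d * l)
      difference = solve 3 (λ c d l → (c :- d) :* l := c :* l :+ (:- con (+ 1)) :* (d :* l)) refl
      difference-poly : IsPoly (c N * lc N + - 1# * (d N * lc N)) N
                          (λ x → Σ[ 0 ⋯ N ] (λ k → c k * b k x) + - 1# * Σ[ 0 ⋯ N ] (λ k → d k * b k x))
      difference-poly = IsPoly-+ (Σ-IsPoly N c) (IsPoly-*ˡ (- 1#) (Σ-IsPoly N d))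
      vanishes : ∀ i → Σ[ 0 ⋯ N ] (λ k → c k * b k (p i)) + - 1# * Σ[ 0 ⋯ N ] (λ k → d k * b k (p i)) ≈ 0#
      vanishes i = trans (+-congʳ (Σc≈Σd (p i))) (cancel _)
        where
        cancel : ∀ s → s + - 1# * s ≈ 0#
        cancel = solve 1 (λ s → s :+ (:- con (+ 1)) :* s := con (+ 0)) refl
    ... | inj₁ c-d≈0 = x∙y⁻¹≈ε⇒x≈y (c N) (d N) c-d≈0
    ... | inj₂ lc≈0  = ⊥-elim (lc≉0 N lc≈0)

    coefficients-unique : ∀ N (c d : ℕ → Carrier) →
      (∀ x → Σ[ 0 ⋯ N ] (λ k → c k * b k x) ≈ Σ[ 0 ⋯ N ] (λ k → d k * b k x)) → ∀ k → k ≤ N → c k ≈ d k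
    coefficients-unique zero    c d Σc≈Σd zero _ = top-coefficient-unique zero c d Σc≈Σd
    coefficients-unique (suc N) c d Σc≈Σd k k≤1+N with NP.m≤n⇒m<n∨m≡n k≤1+N
    ... | inj₂ ≡.refl = top-coefficient-unique (suc N) c d Σc≈Σd
    ... | inj₁ k<1+N  = coefficients-unique N c d Σc≈Σd′ k (N.s≤s⁻¹ k<1+N)
      where
      Σc≈Σd′ : ∀ x → Σ[ 0 ⋯ N ] (λ k → c k * b k x) ≈ Σ[ 0 ⋯ N ] (λ k → d k * b k x)
      Σc≈Σd′ x = ∙-cancelʳ (d (suc N) * b (suc N) x) _ _
        (trans (+-congˡ (*-congʳ (sym (top-coefficient-unique (suc N) c d Σc≈Σd)))) (Σc≈Σd x))

  whitney-basis-IsPoly : ∀ m lam k → IsPoly (pow (fromℕ m) k) k (λ x → fallλ (fromℕ m * x + 1#) lam k)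
  whitney-basis-IsPoly m lam zero    = constant (λ _ → refl)
  whitney-basis-IsPoly m lam (suc k) =
    IsPoly-cong (IsPoly-+ (IsPoly-*ˡ μ (IsPoly-x* P)) (IsPoly-raise (IsPoly-*ˡ (1# - fromℕ k * lam) P)))
      (λ x → sym (identity (fallλ (μ * x + 1#) lam k) μ x (fromℕ k * lam)))
      (trans (+-identityʳ _) (*-comm μ (pow μ k)))
    where
    μ : Carrier
    μ = fromℕ m
    P : IsPoly (pow μ k) k (λ x → fallλ (μ * x + 1#) lam k)
    P = whitney-basis-IsPoly m lam k
    identity : ∀ F μ x c → F * ((μ * x + 1#) - c) ≈ μ * (x * F) + (1# - c) * F
    identity = solve 4 (λ F μ x c → F :* ((μ :* x :+ con (+ 1)) :- c) := μ :* (x :* F) :+ (con (+ 1) :- c) :* F) refl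

  whitneyCoeff : ℕ → Carrier → (ℕ → ℕ → Carrier) → ℕ → ℕ → Carrier
  whitneyCoeff m lam S1λ n k =
    Σ[ k ⋯ n ] (λ j → Σ[ k ⋯ j ] (λ l →
      shiftCoeff lam l k * Σ[ l ⋯ j ] (λ i → S1λ i l * fromℕ (S₂ j i)) * fromℤ (S₁ n j) * pow (fromℕ m) (n ∸ j)))

  whitney-expansion : ∀ m lam S1λ → IsDegStirling1 lam S1λ → ∀ n x →
    pow (fromℕ m) n * fall x n ≈ Σ[ 0 ⋯ n ] (λ k → whitneyCoeff m lam S1λ n k * fallλ (fromℕ m * x + 1#) lam k)
  whitney-expansion m lam S1λ S1λ-expansion n x = begin
    pow μ n * fall x n
      ≈⟨ Σ-compose n A D (pow y) b scaled-fall-expansion (λ j _ → pow-y-expansion j) ⟩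
    Σ[ 0 ⋯ n ] (λ k → Σ[ k ⋯ n ] (λ j → D j k * A j) * b k)
      ≈⟨ sumFrom-cong 0 (suc n) (λ k → *-congʳ (sumFrom-cong k (suc n ∸ k) (distribute k))) ⟩
    Σ[ 0 ⋯ n ] (λ k → whitneyCoeff m lam S1λ n k * b k)
      ∎
    where
    μ y z : Carrier
    μ = fromℕ m
    y = μ * x
    z = y + 1#

    A : ℕ → Carrier
    A j = fromℤ (S₁ n j) * pow μ (n ∸ j)

    C : ℕ → ℕ → Carrier
    C j l = Σ[ l ⋯ j ] (λ i → S1λ i l * fromℕ (S₂ j i))

    D : ℕ → ℕ → Carrier
    D j k = Σ[ k ⋯ j ] (λ l → shiftCoeff lam l k * C j l)

    b : ℕ → Carrier
    b = fallλ z lam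

    scaled-fall-expansion : pow μ n * fall x n ≈ Σ[ 0 ⋯ n ] (λ j → A j * pow y j)
    scaled-fall-expansion = begin
      pow μ n * fall x n                                     ≈⟨ *-congˡ (fall-expansion x n) ⟩
      pow μ n * Σ[ 0 ⋯ n ] (λ j → fromℤ (S₁ n j) * pow x j)  ≈⟨ sumFrom-distribˡ 0 (suc n) (pow μ n) _ ⟩
      Σ[ 0 ⋯ n ] (λ j → pow μ n * (fromℤ (S₁ n j) * pow x j)) ≈⟨ Σ-cong≤ n scale ⟩
      Σ[ 0 ⋯ n ] (λ j → A j * pow y j)                       ∎
      where
      scale : ∀ j → j ≤ n → pow μ n * (fromℤ (S₁ n j) * pow x j) ≈ A j * pow y j
      scale j j≤n = begin
        pow μ n * (s * pow x j)
          ≡⟨ ≡.cong (λ k → pow μ k * (s * pow x j)) (≡.sym (NP.m∸n+n≡m j≤n)) ⟩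
        pow μ (n ∸ j N.+ j) * (s * pow x j)
          ≈⟨ *-congʳ (pow-+ μ (n ∸ j) j) ⟩
        pow μ (n ∸ j) * pow μ j * (s * pow x j)
          ≈⟨ reorder (pow μ (n ∸ j)) (pow μ j) s (pow x j) ⟩
        s * pow μ (n ∸ j) * (pow μ j * pow x j)
          ≈⟨ *-congˡ (sym (pow-distrib-* μ x j)) ⟩
        A j * pow y j
          ∎
        where
        s : Carrier
        s = fromℤ (S₁ n j)
        reorder : ∀ p q s t → p * q * (s * t) ≈ s * p * (q * t)
        reorder = solve 4 (λ p q s t → p :* q :* (s :* t) := s :* p :* (q :* t)) refl

    fallλ-y-expansion : ∀ l → fallλ y lam l ≈ Σ[ 0 ⋯ l ] (λ k → shiftCoeff lam l k * b k)
    fallλ-y-expansion l = trans (fallλ-cong lam l y≈z-1) (fallλ-shift-expansion lam z l)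
      where
      y≈z-1 : y ≈ z - 1#
      y≈z-1 = solve 1 (λ y → y := (y :+ con (+ 1)) :- con (+ 1)) refl y

    pow-y-expansion : ∀ j → pow y j ≈ Σ[ 0 ⋯ j ] (λ k → D j k * b k)
    pow-y-expansion j =
      Σ-compose j (C j) (shiftCoeff lam) (fallλ y lam) b
        (Σ-compose j (λ i → fromℕ (S₂ j i)) S1λ (fall y) (fallλ y lam) (pow-expansion y j) (λ i _ → S1λ-expansion i y))
        (λ l _ → fallλ-y-expansion l)

    distribute : ∀ k j → D j k * A j ≈ Σ[ k ⋯ j ] (λ l → shiftCoeff lam l k * C j l * fromℤ (S₁ n j) * pow μ (n ∸ j))
    distribute k j = begin
      D j k * (fromℤ (S₁ n j) * pow μ (n ∸ j))
        ≈⟨ sym (*-assoc _ _ _) ⟩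
      D j k * fromℤ (S₁ n j) * pow μ (n ∸ j)
        ≈⟨ *-congʳ (sumFrom-distribʳ k (suc j ∸ k) _ _) ⟩
      Σ[ k ⋯ j ] (λ l → shiftCoeff lam l k * C j l * fromℤ (S₁ n j)) * pow μ (n ∸ j)
        ≈⟨ sumFrom-distribʳ k (suc j ∸ k) _ _ ⟩
      Σ[ k ⋯ j ] (λ l → shiftCoeff lam l k * C j l * fromℤ (S₁ n j) * pow μ (n ∸ j))
        ∎

  whitney-coefficients : CharZero → NoZeroDivisors → ∀ m → ¬ (fromℕ m ≈ 0#) →
    ∀ lam S1λ → IsDegStirling1 lam S1λ → ∀ V → IsDegWhitney1 m lam V →
    ∀ n k → k ≤ n → V n k ≈ whitneyCoeff m lam S1λ n k
  whitney-coefficients char0 nzd m m≉0 lam S1λ S1λ-expansion V V-expansion n =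
    coefficients-unique n (V n) (whitneyCoeff m lam S1λ n)
      (λ x → trans (sym (V-expansion n x)) (whitney-expansion m lam S1λ S1λ-expansion n x))
    where
    open ExpansionUniqueness nzd fromℕ (fromℕ-distinct char0) (λ k x → fallλ (fromℕ m * x + 1#) lam k) (pow (fromℕ m))
      (whitney-basis-IsPoly m lam) (pow≉0 nzd (1#≉0# char0) m≉0)

theorem8 : {c ℓ : Level} (R : CommutativeRing c ℓ) →
    let open CommutativeRing R
        open Ops R
    in CharZero → NoZeroDivisors →
       (m : ℕ) → .{{_ : NonZero m}} →
       (lam : Carrier) → ¬ (lam ≈ 0#) →
       (S1λ : ℕ → ℕ → Carrier) → IsDegStirling1 lam S1λ →
       (V : ℕ → ℕ → Carrier) → IsDegWhitney1 m lam V →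
       (n k : ℕ) → k ≤ n →
       V n k ≈ Σ[ k ⋯ n ] (λ j → Σ[ k ⋯ j ] (λ l →
                 fromℕ (binom l k) * pow (- 1#) (l ∸ k) * riseλ 1# lam (l ∸ k)
                 * Σ[ l ⋯ j ] (λ i → S1λ i l * fromℕ (S₂ j i))
                 * fromℤ (S₁ n j) * pow (fromℕ m) (n ∸ j)))
theorem8 R char0 nzd (suc m) lam _ S1λ S1λ-expansion V V-expansion =
  whitney-coefficients R char0 nzd (suc m) (char0 m) lam S1λ S1λ-expansion V V-expansion
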